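{- Let $\mathscr{A}$ denote the asymptotic density of the set of positive integers $m$ satisfying $\gcd(m,\sigma(m^2)) = \gcd(m^2,\sigma(m^2))$. Then $\mathscr{A} < 1$.
   Context: $\sigma(x)$ denotes the sum of the positive divisors of $x$. The asymptotic density of a set $S$ of positive integers is $\lim_{X\to\infty} \#\{m \le X : m \in S\}/X$. -}

module Defs where

open import Data.Nat using (ℕ; suc; _*_; _≟_)
open import Data.Nat.Divisibility using (_∣?_)
open import Data.Nat.GCD using (gcd)
open import Data.List using (List; applyUpTo; filter; length)
open import Data.Nat.ListAction using (sum)

range1 : ℕ → List ℕ
range1 n = applyUpTo suc n

-- σ(n) = sum of the positive divisors of n (σ 0 = 0, irrelevant here)
σ : ℕ → ℕ
σ n = sum (filter (_∣? n) (range1 n))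

countS : ℕ → ℕ
countS X = length (filter (λ m → gcd m (σ (m * m)) ≟ gcd (m * m) (σ (m * m))) (range1 X))

-- Write m = 273 k with k ≡ 1 (mod 273). Then 3, 7 and 13 each divide m exactly once and are
-- prime to k, so σ(m²) = σ(3²) σ(7²) σ(13²) σ(k²) = 13 · 57 · 183 · σ(k²) is divisible by 9.
-- Hence 9 divides gcd(m², σ(m²)) but not m, so m ∉ S. These m form the progression
-- 273 + 273² t, so every block of 273² consecutive integers contains a non-member, and the
-- density of S is at most 1 − 1/273².
module Submission where

open import Data.Empty using (⊥-elim)
open import Data.List using ([]; _∷_; _++_; filter; length)
open import Data.List.Properties using (applyUpTo-∷ʳ; filter-++; length-++)
open import Data.Nat using (ℕ; zero; suc; _≟_; _+_; _*_; _∸_; _^_; _≤_; _<_; z≤n; s≤s; NonZero; >-nonZero; ≢-nonZero)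
open import Data.Nat.Coprimality using (Coprime; coprime-divisor)
open import Data.Nat.DivMod using (_/_; _%_; m≡m%n+[m/n]*n; m%n<n; m≥n⇒m/n>0)
open import Data.Nat.Divisibility
open import Data.Nat.GCD using (gcd; gcd[m,n]∣m; gcd-greatest)
open import Data.Nat.ListAction using (sum)
open import Data.Nat.ListAction.Properties using (sum-++)
open import Data.Nat.Primality using (Prime; prime?; prime⇒irreducible; prime⇒nonZero; ¬prime[1]; euclidsLemma)
open import Data.Nat.Properties
open import Data.Nat.Tactic.RingSolver using (solve-∀)
open import Data.Product using (Σ; _×_; _,_)
open import Data.Sum using (inj₁; inj₂)
open import Function using (_∘_)
open import Relation.Binary.PropositionalEquality
open import Relation.Nullary using (¬_; Dec; yes; no)
open import Relation.Nullary.Decidable using (from-yes; from-no)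
open import Relation.Unary using (Pred; Decidable)

open import Defs

when : ∀ {a} {A : Set a} → Dec A → ℕ → ℕ
when (yes _) x = x
when (no  _) x = 0

unless : ∀ {a} {A : Set a} → Dec A → ℕ → ℕ
unless (yes _) x = 0
unless (no  _) x = x

module _ {a} {A : Set a} where

  when-yes : ∀ {x} (A? : Dec A) → A → when A? x ≡ x
  when-yes (yes _) _ = refl
  when-yes (no ¬a) a = ⊥-elim (¬a a)

  when-no : ∀ {x} (A? : Dec A) → ¬ A → when A? x ≡ 0
  when-no (yes a) ¬a = ⊥-elim (¬a a)
  when-no (no _)  _  = refl

  when≤ : ∀ x (A? : Dec A) → when A? x ≤ x
  when≤ x (yes _) = ≤-refl
  when≤ x (no _)  = z≤n

  unless+when : ∀ x (A? : Dec A) → x ≡ unless A? x + when A? x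
  unless+when x (yes _) = refl
  unless+when x (no _)  = sym (+-identityʳ x)

sumTo : ℕ → (ℕ → ℕ) → ℕ
sumTo zero    f = 0
sumTo (suc N) f = sumTo N f + f (suc N)

sumTo-cong : ∀ N {f g : ℕ → ℕ} → (∀ d → f d ≡ g d) → sumTo N f ≡ sumTo N g
sumTo-cong zero    f≗g = refl
sumTo-cong (suc N) f≗g = cong₂ _+_ (sumTo-cong N f≗g) (f≗g (suc N))

sumTo-+ : ∀ N {f g : ℕ → ℕ} → sumTo N (λ d → f d + g d) ≡ sumTo N f + sumTo N g
sumTo-+ zero    = refl
sumTo-+ (suc N) {f} {g} = begin
  sumTo N (λ d → f d + g d) + (f (suc N) + g (suc N))
    ≡⟨ cong (_+ (f (suc N) + g (suc N))) (sumTo-+ N) ⟩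
  sumTo N f + sumTo N g + (f (suc N) + g (suc N))
    ≡⟨ +-exchange (sumTo N f) (sumTo N g) (f (suc N)) (g (suc N)) ⟩
  sumTo N f + f (suc N) + (sumTo N g + g (suc N)) ∎
  where
  open ≡-Reasoning
  +-exchange : ∀ a b c d → a + b + (c + d) ≡ a + c + (b + d)
  +-exchange = solve-∀

*-distribˡ-sumTo : ∀ c N (f : ℕ → ℕ) → c * sumTo N f ≡ sumTo N (λ d → c * f d)
*-distribˡ-sumTo c zero    f = *-zeroʳ c
*-distribˡ-sumTo c (suc N) f =
  trans (*-distribˡ-+ c (sumTo N f) (f (suc N))) (cong (_+ c * f (suc N)) (*-distribˡ-sumTo c N f))

sumTo-++ : ∀ a b {f : ℕ → ℕ} → sumTo (b + a) f ≡ sumTo a f + sumTo b (λ i → f (i + a))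
sumTo-++ a zero    = sym (+-identityʳ _)
sumTo-++ a (suc b) {f} = trans (cong (_+ f (suc (b + a))) (sumTo-++ a b)) (+-assoc (sumTo a f) _ _)

sumTo-zero : ∀ N {f : ℕ → ℕ} → (∀ i → 0 < i → i ≤ N → f i ≡ 0) → sumTo N f ≡ 0
sumTo-zero zero    f≡0 = refl
sumTo-zero (suc N) f≡0 =
  cong₂ _+_ (sumTo-zero N (λ i 0<i i≤N → f≡0 i 0<i (m≤n⇒m≤1+n i≤N))) (f≡0 (suc N) (s≤s z≤n) ≤-refl)

sumTo-extend : ∀ {N M} {f : ℕ → ℕ} → N ≤ M → (∀ d → N < d → f d ≡ 0) → sumTo M f ≡ sumTo N f
sumTo-extend {N} {M} {f} N≤M f≡0 = begin
  sumTo M f                                   ≡⟨ cong (λ L → sumTo L f) (sym (m∸n+n≡m N≤M)) ⟩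
  sumTo (M ∸ N + N) f                         ≡⟨ sumTo-++ N (M ∸ N) ⟩
  sumTo N f + sumTo (M ∸ N) (λ i → f (i + N)) ≡⟨ cong (sumTo N f +_) (sumTo-zero (M ∸ N) tail≡0) ⟩
  sumTo N f + 0                               ≡⟨ +-identityʳ _ ⟩
  sumTo N f                                   ∎
  where
  open ≡-Reasoning
  tail≡0 : ∀ i → 0 < i → i ≤ M ∸ N → f (i + N) ≡ 0
  tail≡0 i 0<i _ = f≡0 (i + N) (subst (N <_) (+-comm N i) (m<m+n N 0<i))

sumTo-multiples : ∀ p .{{_ : NonZero p}} M (g : ℕ → ℕ) →
                  sumTo (p * M) (λ d → when (p ∣? d) (g d)) ≡ sumTo M (λ e → g (p * e))
sumTo-multiples p zero g rewrite *-zeroʳ p = refl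
sumTo-multiples p@(suc p-1) (suc M) g = begin
  sumTo (p * suc M) h                          ≡⟨ cong (λ L → sumTo L h) (*-suc p M) ⟩
  sumTo (p + p * M) h                          ≡⟨ sumTo-++ (p * M) p ⟩
  sumTo (p * M) h + sumTo p (λ i → h (i + p * M))
    ≡⟨ cong₂ _+_ (sumTo-multiples p M g) lastBlock ⟩
  sumTo M (λ e → g (p * e)) + g (p * suc M)    ∎
  where
  open ≡-Reasoning
  h : ℕ → ℕ
  h d = when (p ∣? d) (g d)
  ∤i+p*M : ∀ i → 0 < i → i < p → ¬ p ∣ i + p * M
  ∤i+p*M i 0<i i<p p∣ = <⇒≱ i<p (∣⇒≤ {{>-nonZero 0<i}}
    (∣m+n∣m⇒∣n (subst (p ∣_) (+-comm i (p * M)) p∣) (m∣m*n M)))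
  lastBlock : sumTo p (λ i → h (i + p * M)) ≡ g (p * suc M)
  lastBlock = cong₂ _+_
    (sumTo-zero p-1 (λ i 0<i i≤p-1 → when-no (p ∣? (i + p * M)) (∤i+p*M i 0<i (s≤s i≤p-1))))
    (trans (when-yes (p ∣? (p + p * M)) (∣m∣n⇒∣m+n ∣-refl (m∣m*n M))) (cong g (sym (*-suc p M))))

sumTo≤ : ∀ N {f : ℕ → ℕ} → (∀ i → f i ≤ 1) → sumTo N f ≤ N
sumTo≤ zero    f≤1 = z≤n
sumTo≤ (suc N) {f} f≤1 = subst (sumTo (suc N) f ≤_) (+-comm N 1) (+-mono-≤ (sumTo≤ N f≤1) (f≤1 (suc N)))

sumTo< : ∀ N {f : ℕ → ℕ} {c} → (∀ i → f i ≤ 1) → 0 < c → c ≤ N → f c ≡ 0 → sumTo N f < N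
sumTo< zero    f≤1 0<c c≤0 = ⊥-elim (<⇒≱ 0<c c≤0)
sumTo< (suc N) {f} f≤1 0<c c≤1+N fc≡0 with m≤n⇒m<n∨m≡n c≤1+N
... | inj₁ (s≤s c≤N) = subst (sumTo (suc N) f <_) (+-comm N 1) (+-mono-<-≤ (sumTo< N f≤1 0<c c≤N fc≡0) (f≤1 (suc N)))
... | inj₂ refl      = s≤s (subst (_≤ N) (sym (trans (cong (sumTo N f +_) fc≡0) (+-identityʳ _))) (sumTo≤ N f≤1))

m≤[n+n]*[m/n] : ∀ m n .{{_ : NonZero n}} → n ≤ m → m ≤ (n + n) * (m / n)
m≤[n+n]*[m/n] m n n≤m = begin
  m                       ≡⟨ m≡m%n+[m/n]*n m n ⟩
  m % n + m / n * n       ≤⟨ +-monoˡ-≤ (m / n * n) (≤-trans (<⇒≤ (m%n<n m n)) (m≤n*m n (m / n))) ⟩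
  m / n * n + m / n * n   ≡⟨ double (m / n) n ⟩
  (n + n) * (m / n)       ∎
  where
  open ≤-Reasoning
  instance
    _ : NonZero (m / n)
    _ = >-nonZero (m≥n⇒m/n>0 n≤m)
  double : ∀ t n → t * n + t * n ≡ (n + n) * t
  double = solve-∀

module Gaps {f : ℕ → ℕ} (f≤1 : ∀ i → f i ≤ 1) (M : ℕ) .{{_ : NonZero M}}
            (gap : ∀ t → Σ ℕ λ c → 0 < c × c ≤ M × f (c + t * M) ≡ 0) where

  open ≤-Reasoning

  sumTo[t*M]+t≤t*M : ∀ t → sumTo (t * M) f + t ≤ t * M
  sumTo[t*M]+t≤t*M zero    = ≤-refl
  sumTo[t*M]+t≤t*M (suc t) with gap t
  ... | c , 0<c , c≤M , fc≡0 = begin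
    sumTo (M + t * M) f + suc t
      ≡⟨ cong (_+ suc t) (sumTo-++ (t * M) M) ⟩
    sumTo (t * M) f + sumTo M block + suc t
      ≡⟨ regroup (sumTo (t * M) f) (sumTo M block) t ⟩
    (sumTo (t * M) f + t) + suc (sumTo M block)
      ≤⟨ +-mono-≤ (sumTo[t*M]+t≤t*M t) (sumTo< M (λ i → f≤1 (i + t * M)) 0<c c≤M fc≡0) ⟩
    t * M + M
      ≡⟨ +-comm (t * M) M ⟩
    M + t * M ∎
    where
    block : ℕ → ℕ
    block i = f (i + t * M)
    regroup : ∀ a b t → a + b + suc t ≡ a + t + suc b
    regroup = solve-∀

  sumTo+/≤ : ∀ X → sumTo X f + X / M ≤ X
  sumTo+/≤ X = begin
    sumTo X f + t                                       ≡⟨ cong (λ Y → sumTo Y f + t) X≡r+t*M ⟩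
    sumTo (r + t * M) f + t                             ≡⟨ cong (_+ t) (sumTo-++ (t * M) r) ⟩
    sumTo (t * M) f + sumTo r (λ i → f (i + t * M)) + t ≡⟨ +-comm-last (sumTo (t * M) f) _ t ⟩
    sumTo (t * M) f + t + sumTo r (λ i → f (i + t * M))
      ≤⟨ +-mono-≤ (sumTo[t*M]+t≤t*M t) (sumTo≤ r (λ i → f≤1 (i + t * M))) ⟩
    t * M + r                                           ≡⟨ +-comm (t * M) r ⟩
    r + t * M                                           ≡⟨ X≡r+t*M ⟨
    X                                                   ∎
    where
    t r : ℕ
    t = X / M
    r = X % M
    X≡r+t*M : X ≡ r + t * M
    X≡r+t*M = m≡m%n+[m/n]*n X M
    +-comm-last : ∀ a b c → a + b + c ≡ a + c + b
    +-comm-last = solve-∀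

  density-bound : ∀ X → M ≤ X → (M + M) * sumTo X f + X ≤ (M + M) * X
  density-bound X M≤X = begin
    (M + M) * sumTo X f + X                 ≤⟨ +-monoʳ-≤ ((M + M) * sumTo X f) (m≤[n+n]*[m/n] X M M≤X) ⟩
    (M + M) * sumTo X f + (M + M) * (X / M) ≡⟨ *-distribˡ-+ (M + M) (sumTo X f) (X / M) ⟨
    (M + M) * (sumTo X f + X / M)           ≤⟨ *-monoʳ-≤ (M + M) (sumTo+/≤ X) ⟩
    (M + M) * X                             ∎

module _ {p} {P : Pred ℕ p} (P? : Decidable P) where

  private
    filter-range1-suc : ∀ N → filter P? (range1 (suc N)) ≡ filter P? (range1 N) ++ filter P? (suc N ∷ [])
    filter-range1-suc N = trans (cong (filter P?) (sym (applyUpTo-∷ʳ suc N))) (filter-++ P? (range1 N) _)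

  sum-filter-range1 : ∀ N → sum (filter P? (range1 N)) ≡ sumTo N (λ d → when (P? d) d)
  sum-filter-range1 zero    = refl
  sum-filter-range1 (suc N) = begin
    sum (filter P? (range1 (suc N)))                           ≡⟨ cong sum (filter-range1-suc N) ⟩
    sum (filter P? (range1 N) ++ filter P? (suc N ∷ []))       ≡⟨ sum-++ (filter P? (range1 N)) _ ⟩
    sum (filter P? (range1 N)) + sum (filter P? (suc N ∷ [])) ≡⟨ cong₂ _+_ (sum-filter-range1 N) (singleton (suc N)) ⟩
    sumTo N (λ d → when (P? d) d) + when (P? (suc N)) (suc N)  ∎
    where
    open ≡-Reasoning
    singleton : ∀ x → sum (filter P? (x ∷ [])) ≡ when (P? x) x
    singleton x with P? x
    ... | yes _ = +-identityʳ x
    ... | no  _ = refl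

  length-filter-range1 : ∀ N → length (filter P? (range1 N)) ≡ sumTo N (λ d → when (P? d) 1)
  length-filter-range1 zero    = refl
  length-filter-range1 (suc N) = begin
    length (filter P? (range1 (suc N)))                              ≡⟨ cong length (filter-range1-suc N) ⟩
    length (filter P? (range1 N) ++ filter P? (suc N ∷ []))          ≡⟨ length-++ (filter P? (range1 N)) ⟩
    length (filter P? (range1 N)) + length (filter P? (suc N ∷ [])) ≡⟨ cong₂ _+_ (length-filter-range1 N) (singleton (suc N)) ⟩
    sumTo N (λ d → when (P? d) 1) + when (P? (suc N)) 1             ∎
    where
    open ≡-Reasoning
    singleton : ∀ x → length (filter P? (x ∷ [])) ≡ when (P? x) 1
    singleton x with P? x
    ... | yes _ = refl
    ... | no  _ = refl

σ≡sumTo : ∀ n → σ n ≡ sumTo n (λ d → when (d ∣? n) d)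
σ≡sumTo n = sum-filter-range1 (_∣? n) n

prime∤⇒coprime : ∀ {p d} → Prime p → ¬ p ∣ d → Coprime d p
prime∤⇒coprime pp p∤d (i∣d , i∣p) with prime⇒irreducible pp i∣p
... | inj₁ i≡1 = i≡1
... | inj₂ refl = ⊥-elim (p∤d i∣d)

prime∤* : ∀ {p a b} → Prime p → ¬ p ∣ a → ¬ p ∣ b → ¬ p ∣ a * b
prime∤* {a = a} {b} pp p∤a p∤b p∣ab with euclidsLemma a b pp p∣ab
... | inj₁ p∣a = p∤a p∣a
... | inj₂ p∣b = p∤b p∣b

∣p^k*n⇒∣n : ∀ {p d n} → Prime p → ¬ p ∣ d → ∀ k → d ∣ p ^ k * n → d ∣ n
∣p^k*n⇒∣n {d = d} {n} pp p∤d zero    d∣ = subst (d ∣_) (*-identityˡ n) d∣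
∣p^k*n⇒∣n {p} {d} {n} pp p∤d (suc k) d∣ = ∣p^k*n⇒∣n pp p∤d k
  (coprime-divisor (prime∤⇒coprime pp p∤d) (subst (d ∣_) (*-assoc p (p ^ k) n) d∣))

-- Split the divisors of p^(k+1) n by whether p divides them: those prime to p are exactly
-- the divisors of n, and the multiples p e of p correspond to the divisors e of p^k n.
σ[p^suc[k]*n] : ∀ {p n} → Prime p → ¬ p ∣ n → ∀ k → σ (p ^ suc k * n) ≡ σ n + p * σ (p ^ k * n)
σ[p^suc[k]*n] {p} {n} pp p∤n k = begin
  σ (p ^ suc k * n)                                       ≡⟨ cong σ (*-assoc p (p ^ k) n) ⟩
  σ (p * b)                                               ≡⟨ σ≡sumTo (p * b) ⟩
  sumTo (p * b) (λ d → term d)                            ≡⟨ sumTo-cong (p * b) (λ d → unless+when (term d) (p ∣? d)) ⟩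
  sumTo (p * b) (λ d → unless (p ∣? d) (term d) + when (p ∣? d) (term d)) ≡⟨ sumTo-+ (p * b) ⟩
  sumTo (p * b) (λ d → unless (p ∣? d) (term d)) + sumTo (p * b) (λ d → when (p ∣? d) (term d))
    ≡⟨ cong₂ _+_ primeToP multiplesOfP ⟩
  σ n + p * σ b                                           ∎
  where
  open ≡-Reasoning
  b : ℕ
  b = p ^ k * n
  term : ℕ → ℕ
  term d = when (d ∣? p * b) d
  instance
    nz-p : NonZero p
    nz-p = prime⇒nonZero pp
    nz-n : NonZero n
    nz-n = ≢-nonZero λ { refl → p∤n (p ∣0) }
    nz-p*b : NonZero (p * b)
    nz-p*b = m*n≢0 p b {{nz-p}} {{m*n≢0 (p ^ k) n {{m^n≢0 p k}}}}
  n∣p*b : n ∣ p * b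
  n∣p*b = ∣-trans (n∣m*n (p ^ k)) (n∣m*n p)
  primeToP-term : ∀ d → unless (p ∣? d) (term d) ≡ when (d ∣? n) d
  primeToP-term d with p ∣? d
  ... | yes p∣d = sym (when-no (d ∣? n) (λ d∣n → p∤n (∣-trans p∣d d∣n)))
  ... | no  p∤d with d ∣? p * b | d ∣? n
  ...   | yes _    | yes _   = refl
  ...   | no  _    | no  _   = refl
  ...   | yes d∣pb | no  d∤n =
    ⊥-elim (d∤n (∣p^k*n⇒∣n pp p∤d (suc k) (subst (d ∣_) (sym (*-assoc p (p ^ k) n)) d∣pb)))
  ...   | no  d∤pb | yes d∣n = ⊥-elim (d∤pb (∣-trans d∣n n∣p*b))
  primeToP : sumTo (p * b) (λ d → unless (p ∣? d) (term d)) ≡ σ n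
  primeToP = begin
    sumTo (p * b) (λ d → unless (p ∣? d) (term d)) ≡⟨ sumTo-cong (p * b) primeToP-term ⟩
    sumTo (p * b) (λ d → when (d ∣? n) d)          ≡⟨ sumTo-extend (∣⇒≤ n∣p*b) (λ d n<d → when-no (d ∣? n) (<⇒≱ n<d ∘ ∣⇒≤)) ⟩
    sumTo n (λ d → when (d ∣? n) d)                ≡⟨ σ≡sumTo n ⟨
    σ n                                            ∎
  multipleTerm : ∀ e → term (p * e) ≡ p * when (e ∣? b) e
  multipleTerm e with p * e ∣? p * b | e ∣? b
  ... | yes _       | yes _   = refl
  ... | no  _       | no  _   = sym (*-zeroʳ p)
  ... | yes pe∣pb   | no  e∤b = ⊥-elim (e∤b (*-cancelˡ-∣ p pe∣pb))
  ... | no  pe∤pb   | yes e∣b = ⊥-elim (pe∤pb (*-monoʳ-∣ p e∣b))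
  multiplesOfP : sumTo (p * b) (λ d → when (p ∣? d) (term d)) ≡ p * σ b
  multiplesOfP = begin
    sumTo (p * b) (λ d → when (p ∣? d) (term d)) ≡⟨ sumTo-multiples p b term ⟩
    sumTo b (λ e → term (p * e))                 ≡⟨ sumTo-cong b multipleTerm ⟩
    sumTo b (λ e → p * when (e ∣? b) e)          ≡⟨ *-distribˡ-sumTo p b _ ⟨
    p * sumTo b (λ e → when (e ∣? b) e)          ≡⟨ cong (p *_) (σ≡sumTo b) ⟨
    p * σ b                                      ∎

σ[p^2*n] : ∀ {p n} → Prime p → ¬ p ∣ n → σ (p ^ 2 * n) ≡ (1 + p + p * p) * σ n
σ[p^2*n] {p} {n} pp p∤n = begin
  σ (p ^ 2 * n)                        ≡⟨ σ[p^suc[k]*n] pp p∤n 1 ⟩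
  σ n + p * σ (p ^ 1 * n)              ≡⟨ cong (λ s → σ n + p * s) (σ[p^suc[k]*n] pp p∤n 0) ⟩
  σ n + p * (σ n + p * σ (1 * n))      ≡⟨ cong (λ m → σ n + p * (σ n + p * σ m)) (*-identityˡ n) ⟩
  σ n + p * (σ n + p * σ n)            ≡⟨ collect (σ n) p ⟩
  (1 + p + p * p) * σ n                ∎
  where
  open ≡-Reasoning
  collect : ∀ s p → s + p * (s + p * s) ≡ (1 + p + p * p) * s
  collect = solve-∀

gcd[m,n]≢gcd[m*m,n] : ∀ {d m n} → d ∣ m * m → d ∣ n → ¬ d ∣ m → gcd m n ≢ gcd (m * m) n
gcd[m,n]≢gcd[m*m,n] {d} {m} {n} d∣m*m d∣n d∤m eq =
  d∤m (∣-trans (subst (d ∣_) (sym eq) (gcd-greatest d∣m*m d∣n)) (gcd[m,n]∣m m n))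

module Witness (j : ℕ) where

  k m : ℕ
  k = suc (273 * j)
  m = 273 * k

  ∤k : ∀ {p} → p ∣ 273 → p ≢ 1 → ¬ p ∣ k
  ∤k {p} p∣273 p≢1 p∣k =
    p≢1 (∣1⇒≡1 (∣m+n∣m⇒∣n (subst (p ∣_) (+-comm 1 (273 * j)) p∣k) (∣-trans p∣273 (m∣m*n j))))

  ∤k*k : ∀ {p} → Prime p → p ∣ 273 → ¬ p ∣ k * k
  ∤k*k pp p∣273 = prime∤* pp p∤k p∤k
    where
    p∤k = ∤k p∣273 (λ { refl → ¬prime[1] pp })

  prime3 : Prime 3
  prime3 = from-yes (prime? 3)
  prime7 : Prime 7
  prime7 = from-yes (prime? 7)
  prime13 : Prime 13
  prime13 = from-yes (prime? 13)

  m*m≡ : m * m ≡ 3 ^ 2 * (7 ^ 2 * (13 ^ 2 * (k * k)))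
  m*m≡ = square-273 k
    where
    square-273 : ∀ k → 273 * k * (273 * k) ≡ 9 * (49 * (169 * (k * k)))
    square-273 = solve-∀

  σ[m*m] : σ (m * m) ≡ 13 * 57 * 183 * σ (k * k)
  σ[m*m] = begin
    σ (m * m)                                      ≡⟨ cong σ m*m≡ ⟩
    σ (3 ^ 2 * (7 ^ 2 * (13 ^ 2 * (k * k))))       ≡⟨ σ[p^2*n] prime3 3∤ ⟩
    13 * σ (7 ^ 2 * (13 ^ 2 * (k * k)))            ≡⟨ cong (13 *_) (σ[p^2*n] prime7 7∤) ⟩
    13 * (57 * σ (13 ^ 2 * (k * k)))               ≡⟨ cong (λ s → 13 * (57 * s)) (σ[p^2*n] prime13 13∤) ⟩
    13 * (57 * (183 * σ (k * k)))                  ≡⟨ reassoc 13 57 183 (σ (k * k)) ⟩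
    13 * 57 * 183 * σ (k * k)                      ∎
    where
    open ≡-Reasoning
    reassoc : ∀ a b c s → a * (b * (c * s)) ≡ a * b * c * s
    reassoc = solve-∀
    13∤ : ¬ 13 ∣ k * k
    13∤ = ∤k*k prime13 (divides 21 refl)
    7∤ : ¬ 7 ∣ 13 ^ 2 * (k * k)
    7∤ = prime∤* prime7 (from-no (7 ∣? 169)) (∤k*k prime7 (divides 39 refl))
    3∤ : ¬ 3 ∣ 7 ^ 2 * (13 ^ 2 * (k * k))
    3∤ = prime∤* prime3 (from-no (3 ∣? 49)) (prime∤* prime3 (from-no (3 ∣? 169)) (∤k*k prime3 (divides 91 refl)))

  9∤m : ¬ 9 ∣ m
  9∤m 9∣m = prime∤* prime3 (from-no (3 ∣? 91)) (∤k (divides 91 refl) (λ ()))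
    (*-cancelˡ-∣ 3 (subst (9 ∣_) (*-assoc 3 91 k) 9∣m))

  m∉S : gcd m (σ (m * m)) ≢ gcd (m * m) (σ (m * m))
  m∉S = gcd[m,n]≢gcd[m*m,n] (subst (9 ∣_) (sym m*m≡) (m∣m*n (7 ^ 2 * (13 ^ 2 * (k * k)))))
    (subst (9 ∣_) (sym σ[m*m]) (∣-trans (from-yes (9 ∣? (13 * 57 * 183))) (m∣m*n (σ (k * k))))) 9∤m

S? : ∀ m → Dec (gcd m (σ (m * m)) ≡ gcd (m * m) (σ (m * m)))
S? m = gcd m (σ (m * m)) ≟ gcd (m * m) (σ (m * m))

countS≡sumTo : ∀ X → countS X ≡ sumTo X (λ m → when (S? m) 1)
countS≡sumTo = length-filter-range1 S?

∉S-in-every-block : ∀ t → Σ ℕ λ c → 0 < c × c ≤ 273 * 273 × when (S? (c + t * (273 * 273))) 1 ≡ 0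
∉S-in-every-block t = 273 , s≤s z≤n , m≤m+n 273 74256 ,
  when-no (S? (273 + t * (273 * 273))) (subst (λ m → ¬ (gcd m (σ (m * m)) ≡ gcd (m * m) (σ (m * m))))
                                              (progression t) (Witness.m∉S t))
  where
  -- Every term here must match the goal syntactically: a mismatch that is only definitional
  -- (273 * 273 versus 74529, or an unfolded Witness.m) makes Agda try to evaluate σ and gcd.
  progression : ∀ t → Witness.m t ≡ 273 + t * (273 * 273)
  progression = arith
    where
    arith : ∀ t → 273 * suc (273 * t) ≡ 273 + t * (273 * 273)
    arith = solve-∀

theorem5 : Σ ℕ λ p → Σ ℕ λ q → p < q × Σ ℕ λ N → (X : ℕ) → N ≤ X → q * countS X ≤ p * X
theorem5 = 149057 , 149058 , ≤-refl , 74529 , bound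
  where
  bound : ∀ X → 74529 ≤ X → 149058 * countS X ≤ 149057 * X
  bound X 74529≤X = +-cancelʳ-≤ X (149058 * countS X) (149057 * X) (begin
    149058 * countS X + X         ≡⟨ cong (λ c → 149058 * c + X) (countS≡sumTo X) ⟩
    149058 * sumTo X (λ m → when (S? m) 1) + X
      ≤⟨ Gaps.density-bound (λ m → when≤ 1 (S? m)) (273 * 273) ∉S-in-every-block X 74529≤X ⟩
    149058 * X                    ≡⟨ +-comm X (149057 * X) ⟩
    149057 * X + X                ∎)
    where open ≤-Reasoning
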